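{- Let $G$ be a graph such that both $G$ and its complement $\overline{G}$ are connected and $|V(G)|\ge 2$. Let $P(G)$ be the partition of $V(G)$ into the maximal modules of $G$ different from $V(G)$, and let $V'\subseteq V(G)$ contain exactly one vertex from each class of $P(G)$ (so that $G(V')$ is a maximal prime induced subgraph of $G$). Let $w:V(G)\to\mathbb{N}$ be an arbitrary function. Then $\chi_w(G)=\chi_{w^*}(G(V'))$, where for each $v\in V'$, $w^*(v)=\chi_w(G(V''))$ with $V''\in P(G)$ the unique class satisfying $\{v\}=V'\cap V''$ (and $\chi_w(G(V''))$ computed with $w$ restricted to $V''$).
   Context: For $U\subseteq V(G)$, $G(U)$ is the induced subgraph on $U$. A set $M\subseteq V(G)$ is a module if every vertex $x\in V(G)\setminus M$ is adjacent either to all elements of $M$ or to none of them. A graph is prime if it has no module $M$ with $1<|M|$ and $M\neq V(G)$. Weighted chromatic number: for a graph $G$ and $w:V(G)\to\mathbb{N}$, $\chi_w(G)$ is the smallest $k$ such that there is a map $c:V(G)\to 2^{\{1,\dots,k\}}$ with $|c(v)|=w(v)$ for all $v$ and $c(v_1)\cap c(v_2)=\emptyset$ for all adjacent $v_1,v_2$. (By Gallai's theorem, when $G$ and $\overline{G}$ are connected and $|V(G)|\ge 2$, the maximal proper modules are pairwise disjoint and partition $V(G)$, and $G(V')$ is prime with at least four vertices.) -}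

module Defs where

open import Data.Nat using (ℕ; _<_)
open import Data.Fin using (Fin)
open import Data.Fin.Subset using (Subset; _∈_; _∉_; _⊆_; _∩_; ∣_∣; Empty)
open import Data.Product using (Σ; _×_; proj₁; ∃)
open import Data.Sum using (_⊎_)
open import Relation.Nullary using (¬_; Dec)
open import Relation.Binary.PropositionalEquality using (_≡_; _≢_)
open import Relation.Binary.Construct.Closure.ReflexiveTransitive using (Star)

record Graph (n : ℕ) : Set₁ where
  field
    Adj    : Fin n → Fin n → Set
    adj?   : ∀ u v → Dec (Adj u v)
    sym    : ∀ {u v} → Adj u v → Adj v u
    irrefl : ∀ {v} → ¬ Adj v v
open Graph public

CoAdj : ∀ {n} → Graph n → Fin n → Fin n → Set
CoAdj G u v = (u ≢ v) × (¬ Adj G u v)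

ConnectedRel : ∀ {n} → (Fin n → Fin n → Set) → Set
ConnectedRel {n} R = ∀ (u v : Fin n) → Star R u v

Connected : ∀ {n} → Graph n → Set
Connected G = ConnectedRel (Adj G)

CoConnected : ∀ {n} → Graph n → Set
CoConnected G = ConnectedRel (CoAdj G)

IsModule : ∀ {n} → Graph n → Subset n → Set
IsModule {n} G M = ∀ (x : Fin n) → x ∉ M →
  (∀ m → m ∈ M → Adj G x m) ⊎ (∀ m → m ∈ M → ¬ Adj G x m)

Proper : ∀ {n} → Subset n → Set
Proper {n} M = ∃ λ (x : Fin n) → x ∉ M

IsMaxProperModule : ∀ {n} → Graph n → Subset n → Set
IsMaxProperModule {n} G M =
  IsModule G M × Proper M ×
  (∀ (M' : Subset n) → IsModule G M' → Proper M' → M ⊆ M' → M' ⊆ M)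

Vtx : ∀ {n} → Subset n → Set
Vtx {n} U = Σ (Fin n) (λ v → v ∈ U)

InducedAdj : ∀ {n} → Graph n → (U : Subset n) → Vtx U → Vtx U → Set
InducedAdj G U a b = Adj G (proj₁ a) (proj₁ b)

restrict : ∀ {n} (U : Subset n) → (Fin n → ℕ) → Vtx U → ℕ
restrict U w a = w (proj₁ a)

-- Weighted colouring with colours {1..k} (here Fin k): each v gets a set of
-- exactly w v colours, adjacent vertices get disjoint sets.
WColorable : {V : Set} → (V → V → Set) → (V → ℕ) → ℕ → Set
WColorable {V} R w k =
  Σ (V → Subset k) λ c →
    (∀ v → ∣ c v ∣ ≡ w v) × (∀ u v → R u v → Empty (c u ∩ c v))

IsWChi : {V : Set} → (V → V → Set) → (V → ℕ) → ℕ → Set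
IsWChi R w k = WColorable R w k × (∀ m → m < k → ¬ WColorable R w m)

-- Every vertex lies in a unique maximal proper module: two of them that meet would be
-- modules covering V(G) without either containing the other, and then the complement of
-- one of them is closed under walks in G or in its complement, contradicting connectivity.
-- Distinct blocks of this partition are either completely joined or not at all, as their
-- representatives in V' are. Hence a colouring of G(V') with weights w* is refined into one
-- of G by colouring each block inside the palette of its representative; conversely, the
-- colours a colouring of G spends on a block form a palette of size at least χ_w of that
-- block, and palettes of adjacent blocks are disjoint.
module Submission where

open import Defs
open import Data.Nat using (ℕ; zero; suc; _≤_; _<_; s≤s)
open import Data.Nat.Properties using (≮⇒≥; <-irrefl; 0≢1+n)
open import Data.Vec using ([]; _∷_; here; there)
open import Data.Fin using (Fin; zero; suc; _≟_)
open import Data.Fin.Properties using (any?; all?)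
open import Data.Fin.Subset
open import Data.Fin.Subset.Properties
open import Data.Fin.Subset.Induction using (⊃-wellFounded)
open import Data.Product using (Σ-syntax; _×_; _,_; proj₁; proj₂; ∃)
open import Data.Sum using (inj₁; inj₂; [_,_])
open import Function using (_∘_)
open import Function.Bundles using (_⇔_; mk⇔)
open import Induction.WellFounded using (module All)
open import Relation.Nullary using (¬_; Dec; Irrelevant; yes; no; contradiction)
open import Relation.Nullary.Decidable using (decidable-stable; _×-dec_; _⊎-dec_; _→-dec_; ¬?)
open import Relation.Unary using (Decidable)
open import Relation.Binary.PropositionalEquality
  using (_≡_; _≢_; refl; cong; subst; subst₂; trans) renaming (sym to ≡-sym)
open import Relation.Binary.Construct.Closure.ReflexiveTransitive using (Star; ε; _◅_)

private
  variable
    k m n : ℕ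
    x y z : Fin n
    p A B C D S M M₁ M₂ N : Subset n

∈-irrelevant : Irrelevant (x ∈ p)
∈-irrelevant here      here      = refl
∈-irrelevant (there a) (there b) = cong there (∈-irrelevant a b)

Vtx-≡ : {u v : Vtx p} → proj₁ u ≡ proj₁ v → u ≡ v
Vtx-≡ {u = x , x∈p} {.x , x∈p′} refl = cong (x ,_) (∈-irrelevant x∈p x∈p′)

∣p∣≡1⇒Nonempty : ∣ p ∣ ≡ 1 → Nonempty p
∣p∣≡1⇒Nonempty {n} {p} ∣p∣≡1 = decidable-stable (nonempty? p) λ p-empty →
  0≢1+n (trans (≡-sym (∣⊥∣≡0 n)) (trans (cong ∣_∣ (≡-sym (Empty-unique p-empty))) ∣p∣≡1))

∣p∣≡1⇒∈-unique : ∣ p ∣ ≡ 1 → x ∈ p → y ∈ p → x ≡ y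
∣p∣≡1⇒∈-unique {p = p} {x} {y} ∣p∣≡1 x∈p y∈p = decidable-stable (x ≟ y) λ x≢y →
  <-irrefl refl (subst₂ _<_ (∣⁅x⁆∣≡1 x) ∣p∣≡1
    (p⊂q⇒∣p∣<∣q∣ (⁅x⁆⊆p , y , y∈p , x≢y ∘ ≡-sym ∘ x∈⁅y⁆⇒x≡y x)))
  where
  ⁅x⁆⊆p : ⁅ x ⁆ ⊆ p
  ⁅x⁆⊆p z∈⁅x⁆ = subst (_∈ p) (≡-sym (x∈⁅y⁆⇒x≡y x z∈⁅x⁆)) x∈p

Empty-∩-mono : A ⊆ C → B ⊆ D → Empty (C ∩ D) → Empty (A ∩ B)
Empty-∩-mono {A = A} {B = B} A⊆C B⊆D disjoint (j , j∈A∩B) =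
  let (j∈A , j∈B) = x∈p∩q⁻ A B j∈A∩B in disjoint (j , x∈p∩q⁺ (A⊆C j∈A , B⊆D j∈B))

Empty-∩-preserved : (f : Subset m → Subset k) → f ⊥ ≡ ⊥ →
  (∀ A B → f (A ∩ B) ≡ f A ∩ f B) → Empty (A ∩ B) → Empty (f A ∩ f B)
Empty-∩-preserved {A = A} {B = B} f f⊥ f∩ disjoint (j , j∈) = ∉⊥ (subst (j ∈_) fA∩fB≡⊥ j∈)
  where
  fA∩fB≡⊥ : f A ∩ f B ≡ ⊥
  fA∩fB≡⊥ = trans (≡-sym (f∩ A B)) (trans (cong f (Empty-unique disjoint)) f⊥)

-- Fin ∣ S ∣ enumerates S in increasing order; expand and compress transport subsets along it.
expand : (S : Subset k) → Subset ∣ S ∣ → Subset k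
expand []            B       = []
expand (inside ∷ S)  (b ∷ B) = b ∷ expand S B
expand (outside ∷ S) B       = outside ∷ expand S B

∣expand∣ : (S : Subset k) (B : Subset ∣ S ∣) → ∣ expand S B ∣ ≡ ∣ B ∣
∣expand∣ []            []            = refl
∣expand∣ (inside ∷ S)  (inside ∷ B)  = cong suc (∣expand∣ S B)
∣expand∣ (inside ∷ S)  (outside ∷ B) = ∣expand∣ S B
∣expand∣ (outside ∷ S) B             = ∣expand∣ S B

expand-⊆ : (S : Subset k) (B : Subset ∣ S ∣) → expand S B ⊆ S
expand-⊆ (inside ∷ S)  (b ∷ B) here      = here
expand-⊆ (inside ∷ S)  (b ∷ B) (there x) = there (expand-⊆ S B x)
expand-⊆ (outside ∷ S) B       (there x) = there (expand-⊆ S B x)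

expand-⊥ : (S : Subset k) → expand S ⊥ ≡ ⊥
expand-⊥ []            = refl
expand-⊥ (inside ∷ S)  = cong (outside ∷_) (expand-⊥ S)
expand-⊥ (outside ∷ S) = cong (outside ∷_) (expand-⊥ S)

expand-∩ : (S : Subset k) (A B : Subset ∣ S ∣) → expand S (A ∩ B) ≡ expand S A ∩ expand S B
expand-∩ []            []      []      = refl
expand-∩ (inside ∷ S)  (a ∷ A) (b ∷ B) = cong (_ ∷_) (expand-∩ S A B)
expand-∩ (outside ∷ S) A       B       = cong (outside ∷_) (expand-∩ S A B)

compress : (S : Subset k) → Subset k → Subset ∣ S ∣
compress []            []      = []
compress (inside ∷ S)  (a ∷ A) = a ∷ compress S A
compress (outside ∷ S) (a ∷ A) = compress S A

∣compress∣ : (S A : Subset k) → A ⊆ S → ∣ compress S A ∣ ≡ ∣ A ∣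
∣compress∣ []            []            _   = refl
∣compress∣ (inside ∷ S)  (inside ∷ A)  A⊆S = cong suc (∣compress∣ S A (drop-∷-⊆ A⊆S))
∣compress∣ (inside ∷ S)  (outside ∷ A) A⊆S = ∣compress∣ S A (drop-∷-⊆ A⊆S)
∣compress∣ (outside ∷ S) (inside ∷ A)  A⊆S = contradiction (A⊆S here) λ ()
∣compress∣ (outside ∷ S) (outside ∷ A) A⊆S = ∣compress∣ S A (drop-∷-⊆ A⊆S)

compress-⊥ : (S : Subset k) → compress S ⊥ ≡ ⊥
compress-⊥ []            = refl
compress-⊥ (inside ∷ S)  = cong (outside ∷_) (compress-⊥ S)
compress-⊥ (outside ∷ S) = compress-⊥ S

compress-∩ : (S A B : Subset k) → compress S (A ∩ B) ≡ compress S A ∩ compress S B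
compress-∩ []            []      []      = refl
compress-∩ (inside ∷ S)  (a ∷ A) (b ∷ B) = cong (_ ∷_) (compress-∩ S A B)
compress-∩ (outside ∷ S) (a ∷ A) (b ∷ B) = compress-∩ S A B

⊆-ofSize : ∀ {t} (S : Subset k) → t ≤ ∣ S ∣ → ∃ λ T → T ⊆ S × ∣ T ∣ ≡ t
⊆-ofSize {k} {t = zero} S _ = ⊥ , ⊆-min S , ∣⊥∣≡0 k
⊆-ofSize {t = suc t} (inside ∷ S) (s≤s t≤∣S∣) =
  let (T , T⊆S , ∣T∣≡t) = ⊆-ofSize S t≤∣S∣ in inside ∷ T , in⊆in T⊆S , cong suc ∣T∣≡t
⊆-ofSize {t = suc t} (outside ∷ S) t≤∣S∣ =
  let (T , T⊆S , ∣T∣≡t) = ⊆-ofSize S t≤∣S∣ in outside ∷ T , out⊆ T⊆S , ∣T∣≡t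

⋃-over : (Fin n → Subset k) → Subset n → Subset k
⋃-over c []            = ⊥
⋃-over c (inside ∷ M)  = c zero ∪ ⋃-over (c ∘ suc) M
⋃-over c (outside ∷ M) = ⋃-over (c ∘ suc) M

⊆-⋃-over : (c : Fin n → Subset k) (M : Subset n) → z ∈ M → c z ⊆ ⋃-over c M
⊆-⋃-over c (inside ∷ M)  here        = p⊆p∪q _
⊆-⋃-over c (inside ∷ M)  (there z∈M) = q⊆p∪q (c zero) _ ∘ ⊆-⋃-over (c ∘ suc) M z∈M
⊆-⋃-over c (outside ∷ M) (there z∈M) = ⊆-⋃-over (c ∘ suc) M z∈M

∈-⋃-over⁻ : ∀ {j} (c : Fin n → Subset k) (M : Subset n) → j ∈ ⋃-over c M → ∃ λ z → z ∈ M × j ∈ c z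
∈-⋃-over⁻ c []            j∈ = contradiction j∈ ∉⊥
∈-⋃-over⁻ c (inside ∷ M)  j∈ with x∈p∪q⁻ (c zero) _ j∈
... | inj₁ j∈c₀ = zero , here , j∈c₀
... | inj₂ j∈⋃  = let (z , z∈M , j∈cz) = ∈-⋃-over⁻ (c ∘ suc) M j∈⋃ in suc z , there z∈M , j∈cz
∈-⋃-over⁻ c (outside ∷ M) j∈ =
  let (z , z∈M , j∈cz) = ∈-⋃-over⁻ (c ∘ suc) M j∈ in suc z , there z∈M , j∈cz

module _ {V : Set} {R : V → V → Set} {w : V → ℕ} where

  WColorableIn : Subset k → Set
  WColorableIn {k} S = Σ[ col ∈ WColorable R w k ] (∀ v → proj₁ col v ⊆ S)

  WColorable⇒WColorableIn : (S : Subset k) → ∣ S ∣ ≡ m → WColorable R w m → WColorableIn S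
  WColorable⇒WColorableIn S refl (c , ∣c∣ , c-proper) =
    ( (λ v → expand S (c v))
    , (λ v → trans (∣expand∣ S (c v)) (∣c∣ v))
    , (λ u v uRv → Empty-∩-preserved (expand S) (expand-⊥ S) (expand-∩ S) (c-proper u v uRv)) )
    , λ v → expand-⊆ S (c v)

  WColorableIn⇒WColorable : WColorableIn S → WColorable R w ∣ S ∣
  WColorableIn⇒WColorable {S = S} ((c , ∣c∣ , c-proper) , c⊆S) =
      (λ v → compress S (c v))
    , (λ v → trans (∣compress∣ S (c v) (c⊆S v)) (∣c∣ v))
    , λ u v uRv → Empty-∩-preserved (compress S) (compress-⊥ S) (compress-∩ S) (c-proper u v uRv)

  IsWChi⇒≤ : IsWChi R w k → WColorable R w m → k ≤ m
  IsWChi⇒≤ (_ , minimal) col = ≮⇒≥ λ m<k → minimal _ m<k col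

IsWChi-⇔ : {V V′ : Set} {R : V → V → Set} {R′ : V′ → V′ → Set} {w : V → ℕ} {w′ : V′ → ℕ} →
  (∀ {k} → WColorable R w k → WColorable R′ w′ k) →
  (∀ {k} → WColorable R′ w′ k → WColorable R w k) →
  ∀ k → IsWChi R w k ⇔ IsWChi R′ w′ k
IsWChi-⇔ to from k =
  mk⇔ (λ (col , minimal) → to col , λ m m<k col′ → minimal m m<k (from col′))
      (λ (col , minimal) → from col , λ m m<k col′ → minimal m m<k (to col′))

Maximal : (Subset n → Set) → Subset n → Set
Maximal P M = P M × (∀ N → P N → M ⊆ N → N ⊆ M)

extend-to-maximal : {P : Subset n → Set} → Decidable P → P M → ∃ λ M′ → M ⊆ M′ × Maximal P M′
extend-to-maximal {n} {P = P} P? = All.wfRec ⊃-wellFounded _ Goal step _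
  where
  Goal : Subset n → Set
  Goal M = P M → ∃ λ M′ → M ⊆ M′ × Maximal P M′

  step : ∀ M → (∀ {N} → N ⊃ M → Goal N) → Goal M
  step M rec PM with anySubset? (λ N → P? N ×-dec M ⊂? N)
  ... | yes (N , PN , M⊂N) =
    let (M′ , N⊆M′ , maximal) = rec M⊂N PN in M′ , ⊆-trans (proj₁ M⊂N) N⊆M′ , maximal
  ... | no ¬larger = M , ⊆-refl , PM , λ N PN M⊆N {x} x∈N →
    decidable-stable (x ∈? M) λ x∉M → ¬larger (N , PN , M⊆N , x , x∈N , x∉M)

proper? : (M : Subset n) → Dec (Proper M)
proper? M = any? (λ x → ¬? (x ∈? M))

⁅x⁆-proper : 2 ≤ n → (x : Fin n) → Proper ⁅ x ⁆
⁅x⁆-proper (s≤s (s≤s _)) zero    = suc zero , x≢y⇒x∉⁅y⁆ {y = zero} λ ()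
⁅x⁆-proper (s≤s (s≤s _)) (suc x) = zero , x≢y⇒x∉⁅y⁆ {y = suc x} λ ()

Star-preserves : ∀ {A : Set} {R : A → A → Set} {P : A → Set} {a b} →
  (∀ {s t} → R s t → P s → P t) → Star R a b → P a → P b
Star-preserves step ε        Px = Px
Star-preserves step (r ◅ rs) Px = Star-preserves step rs (step r Px)

module _ (G : Graph n) where

  module-adj : IsModule G M → y ∉ M → x ∈ M → z ∈ M → Adj G y x → Adj G y z
  module-adj mod y∉M x∈M z∈M yx with mod _ y∉M
  ... | inj₁ all-adj = all-adj _ z∈M
  ... | inj₂ no-adj  = contradiction yx (no-adj _ x∈M)

  isModule? : (M : Subset n) → Dec (IsModule G M)
  isModule? M = all? λ x → ¬? (x ∈? M) →-dec
    (all? (λ m → (m ∈? M) →-dec adj? G x m) ⊎-dec all? (λ m → (m ∈? M) →-dec ¬? (adj? G x m)))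

  ⁅x⁆-isModule : (x : Fin n) → IsModule G ⁅ x ⁆
  ⁅x⁆-isModule x y _ with adj? G y x
  ... | yes yx = inj₁ λ m m∈ → subst (Adj G y) (≡-sym (x∈⁅y⁆⇒x≡y x m∈)) yx
  ... | no ¬yx = inj₂ λ m m∈ → ¬yx ∘ subst (Adj G y) (x∈⁅y⁆⇒x≡y x m∈)

  ∃-maxProperModule∋ : 2 ≤ n → (x : Fin n) → ∃ λ M → IsMaxProperModule G M × x ∈ M
  ∃-maxProperModule∋ 2≤n x =
    let (M , ⁅x⁆⊆M , (mod , proper) , maximal) =
          extend-to-maximal (λ M → isModule? M ×-dec proper? M) (⁅x⁆-isModule x , ⁅x⁆-proper 2≤n x)
    in M , (mod , proper , λ N modN properN → maximal N (modN , properN)) , ⁅x⁆⊆M (x∈⁅x⁆ x)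

  ∪-isModule : IsModule G M₁ → IsModule G M₂ → x ∈ M₁ → x ∈ M₂ → IsModule G (M₁ ∪ M₂)
  ∪-isModule {M₁} {M₂} mod₁ mod₂ x∈M₁ x∈M₂ y y∉
    with mod₁ y (y∉ ∘ p⊆p∪q M₂) | mod₂ y (y∉ ∘ q⊆p∪q M₁ M₂)
  ... | inj₁ adj₁ | inj₁ adj₂ = inj₁ λ m m∈ → [ adj₁ m , adj₂ m ] (x∈p∪q⁻ M₁ M₂ m∈)
  ... | inj₂ non₁ | inj₂ non₂ = inj₂ λ m m∈ → [ non₁ m , non₂ m ] (x∈p∪q⁻ M₁ M₂ m∈)
  ... | inj₁ adj₁ | inj₂ non₂ = contradiction (adj₁ _ x∈M₁) (non₂ _ x∈M₂)
  ... | inj₂ non₁ | inj₁ adj₂ = contradiction (adj₂ _ x∈M₂) (non₁ _ x∈M₁)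

  adj-between-modules : ∀ {x′ y′} → IsModule G M → IsModule G N →
    x ∈ M → x′ ∈ M → y ∈ N → y′ ∈ N → x ∉ N → y′ ∉ M → Adj G x y → Adj G x′ y′
  adj-between-modules modM modN x∈M x′∈M y∈N y′∈N x∉N y′∉M xy =
    sym G (module-adj modM y′∉M x∈M x′∈M (sym G (module-adj modN x∉N y∈N y′∈N xy)))

  crossing-modules-¬cover : Connected G → CoConnected G → IsModule G M₁ → IsModule G M₂ →
    ∀ {c} → x ∈ M₁ → x ∉ M₂ → c ∈ M₂ → c ∉ M₁ → ¬ (∀ z → z ∈ M₁ ∪ M₂)
  crossing-modules-¬cover {M₁ = M₁} {M₂} {x} connected coconnected mod₁ mod₂ {c}
    x∈M₁ x∉M₂ c∈M₂ c∉M₁ cover = c∉M₂ (adj? G x c) c∈M₂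
    where
    in-M₁ : ∀ {s} → s ∉ M₂ → s ∈ M₁
    in-M₁ {s} s∉M₂ =
      [ (λ s∈M₁ → s∈M₁) , (λ s∈M₂ → contradiction s∈M₂ s∉M₂) ] (x∈p∪q⁻ M₁ M₂ (cover s))

    -- Were the edge x–c present, no co-edge could leave the complement of M₂; were it
    -- absent, no edge could.
    c∉M₂ : Dec (Adj G x c) → c ∉ M₂
    c∉M₂ (yes xc) = Star-preserves co-step (coconnected x c) x∉M₂
      where
      co-step : ∀ {s t} → CoAdj G s t → s ∉ M₂ → t ∉ M₂
      co-step (_ , ¬st) s∉M₂ t∈M₂ =
        ¬st (module-adj mod₂ s∉M₂ c∈M₂ t∈M₂
               (sym G (module-adj mod₁ c∉M₁ x∈M₁ (in-M₁ s∉M₂) (sym G xc))))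
    c∉M₂ (no ¬xc) = Star-preserves step (connected x c) x∉M₂
      where
      step : ∀ {s t} → Adj G s t → s ∉ M₂ → t ∉ M₂
      step st s∉M₂ t∈M₂ =
        ¬xc (sym G (module-adj mod₁ c∉M₁ (in-M₁ s∉M₂) x∈M₁
                      (sym G (module-adj mod₂ s∉M₂ t∈M₂ c∈M₂ st))))

  maxProperModules-⊆ : Connected G → CoConnected G →
    IsMaxProperModule G M₁ → IsMaxProperModule G M₂ → x ∈ M₁ → x ∈ M₂ → M₁ ⊆ M₂
  maxProperModules-⊆ {M₁ = M₁} {M₂} connected coconnected
    (mod₁ , (c , c∉M₁) , _) (mod₂ , _ , maximal₂) x∈M₁ x∈M₂ {y} y∈M₁ =
    decidable-stable (y ∈? M₂) (¬y∉M₂ (proper? (M₁ ∪ M₂)))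
    where
    ¬y∉M₂ : Dec (Proper (M₁ ∪ M₂)) → ¬ y ∉ M₂
    ¬y∉M₂ (yes proper) y∉M₂ =
      y∉M₂ (maximal₂ (M₁ ∪ M₂) (∪-isModule mod₁ mod₂ x∈M₁ x∈M₂) proper
                     (q⊆p∪q M₁ M₂) (p⊆p∪q M₂ y∈M₁))
    ¬y∉M₂ (no ¬proper) y∉M₂ =
      crossing-modules-¬cover connected coconnected mod₁ mod₂ y∈M₁ y∉M₂ c∈M₂ c∉M₁ cover
      where
      cover : ∀ z → z ∈ M₁ ∪ M₂
      cover z = decidable-stable (z ∈? M₁ ∪ M₂) λ z∉ → ¬proper (z , z∉)

      c∈M₂ : c ∈ M₂
      c∈M₂ = [ (λ c∈M₁ → contradiction c∈M₁ c∉M₁) , (λ c∈M₂ → c∈M₂) ] (x∈p∪q⁻ M₁ M₂ (cover c))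

module Quotient (G : Graph n) (2≤n : 2 ≤ n) (connected : Connected G) (coconnected : CoConnected G)
  (V′ : Subset n) (transversal : ∀ M → IsMaxProperModule G M → ∣ V′ ∩ M ∣ ≡ 1) where

  -- Abstract: unfolding the search that produces these choices makes type checking blow up.
  abstract
    block : Fin n → Subset n
    block x = proj₁ (∃-maxProperModule∋ G 2≤n x)

    block-isMax : (x : Fin n) → IsMaxProperModule G (block x)
    block-isMax x = proj₁ (proj₂ (∃-maxProperModule∋ G 2≤n x))

    x∈block : (x : Fin n) → x ∈ block x
    x∈block x = proj₂ (proj₂ (∃-maxProperModule∋ G 2≤n x))

    block-⊆ : z ∈ block x → z ∈ block y → block x ⊆ block y
    block-⊆ = maxProperModules-⊆ G connected coconnected (block-isMax _) (block-isMax _)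

    V′∩block : (x : Fin n) → ∃ λ r → r ∈ V′ × r ∈ block x
    V′∩block x = let (r , r∈) = ∣p∣≡1⇒Nonempty (transversal _ (block-isMax x)) in r , x∈p∩q⁻ V′ _ r∈

    rep : Fin n → Vtx V′
    rep x = let (r , r∈V′ , _) = V′∩block x in r , r∈V′

    x∈block-rep : (x : Fin n) → x ∈ block (proj₁ (rep x))
    x∈block-rep x = let (r , _ , r∈block) = V′∩block x in block-⊆ r∈block (x∈block r) (x∈block x)

  rep-unique : (u v : Vtx V′) → z ∈ block (proj₁ u) → z ∈ block (proj₁ v) → u ≡ v
  rep-unique (u , u∈V′) (v , v∈V′) z∈u z∈v = Vtx-≡ (∣p∣≡1⇒∈-unique
    (transversal _ (block-isMax v))
    (x∈p∩q⁺ (u∈V′ , block-⊆ z∈u z∈v (x∈block u)))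
    (x∈p∩q⁺ (v∈V′ , x∈block v)))

  ∉-block : (u v : Vtx V′) → u ≢ v → z ∈ block (proj₁ v) → z ∉ block (proj₁ u)
  ∉-block u v u≢v z∈v z∈u = u≢v (rep-unique u v z∈u z∈v)

  adj-lift : (u v : Vtx V′) → InducedAdj G V′ u v →
    x ∈ block (proj₁ u) → y ∈ block (proj₁ v) → Adj G x y
  adj-lift u v uv x∈u y∈v = adj-between-modules G (proj₁ (block-isMax _)) (proj₁ (block-isMax _))
    (x∈block _) x∈u (x∈block _) y∈v (∉-block v u (u≢v ∘ ≡-sym) (x∈block _)) (∉-block u v u≢v y∈v) uv
    where
    u≢v : u ≢ v
    u≢v refl = irrefl G uv

  adj-project : (u v : Vtx V′) → u ≢ v →
    x ∈ block (proj₁ u) → y ∈ block (proj₁ v) → Adj G x y → InducedAdj G V′ u v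
  adj-project u v u≢v x∈u y∈v = adj-between-modules G (proj₁ (block-isMax _)) (proj₁ (block-isMax _))
    x∈u (x∈block _) y∈v (x∈block _) (∉-block v u (u≢v ∘ ≡-sym) x∈u) (∉-block u v u≢v (x∈block _))

  BlockAdj : (u : Vtx V′) → Vtx (block (proj₁ u)) → Vtx (block (proj₁ u)) → Set
  BlockAdj u = InducedAdj G (block (proj₁ u))

  module _ (w : Fin n → ℕ) (w* : Vtx V′ → ℕ) where

    refine : (∀ u → WColorable (BlockAdj u) (restrict _ w) (w* u)) →
      WColorable (InducedAdj G V′) w* k → WColorable (Adj G) w k
    refine {k} block-colourable (c* , ∣c*∣ , c*-proper) = c , ∣c∣ , c-proper
      where
      inner : ∀ u → WColorableIn {R = BlockAdj u} {w = restrict _ w} (c* u)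
      inner u = WColorable⇒WColorableIn (c* u) (∣c*∣ u) (block-colourable u)

      colour : ∀ u → Vtx (block (proj₁ u)) → Subset k
      colour u = proj₁ (proj₁ (inner u))

      c : Fin n → Subset k
      c x = colour (rep x) (x , x∈block-rep x)

      ∣c∣ : ∀ x → ∣ c x ∣ ≡ w x
      ∣c∣ x = proj₁ (proj₂ (proj₁ (inner (rep x)))) (x , x∈block-rep x)

      same-block : ∀ {u v} → u ≡ v → (x∈u : x ∈ block (proj₁ u)) (y∈v : y ∈ block (proj₁ v)) →
        Adj G x y → Empty (colour u (x , x∈u) ∩ colour v (y , y∈v))
      same-block {u = u} refl x∈u y∈v = proj₂ (proj₂ (proj₁ (inner u))) (_ , x∈u) (_ , y∈v)

      c-proper : ∀ x y → Adj G x y → Empty (c x ∩ c y)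
      c-proper x y xy = by-rep (proj₁ (rep x) ≟ proj₁ (rep y))
        where
        by-rep : Dec (proj₁ (rep x) ≡ proj₁ (rep y)) → Empty (c x ∩ c y)
        by-rep (yes same) = same-block (Vtx-≡ same) (x∈block-rep x) (x∈block-rep y) xy
        by-rep (no differ) = Empty-∩-mono (proj₂ (inner (rep x)) _) (proj₂ (inner (rep y)) _)
          (c*-proper (rep x) (rep y)
            (adj-project (rep x) (rep y) (differ ∘ cong proj₁) (x∈block-rep x) (x∈block-rep y) xy))

    project : (∀ u → IsWChi (BlockAdj u) (restrict _ w) (w* u)) →
      WColorable (Adj G) w k → WColorable (InducedAdj G V′) w* k
    project {k} block-χ (c , ∣c∣ , c-proper) = c* , ∣c*∣ , c*-proper
      where
      palette : Vtx V′ → Subset k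
      palette u = ⋃-over c (block (proj₁ u))

      restricted : ∀ u → WColorableIn {R = BlockAdj u} {w = restrict _ w} (palette u)
      restricted u =
        ((λ z → c (proj₁ z)) , (λ z → ∣c∣ (proj₁ z)) , λ z z′ → c-proper (proj₁ z) (proj₁ z′))
        , λ z → ⊆-⋃-over c _ (proj₂ z)

      w*≤∣palette∣ : ∀ u → w* u ≤ ∣ palette u ∣
      w*≤∣palette∣ u = IsWChi⇒≤ (block-χ u) (WColorableIn⇒WColorable (restricted u))

      c* : Vtx V′ → Subset k
      c* u = proj₁ (⊆-ofSize (palette u) (w*≤∣palette∣ u))

      c*⊆palette : ∀ u → c* u ⊆ palette u
      c*⊆palette u = proj₁ (proj₂ (⊆-ofSize (palette u) (w*≤∣palette∣ u)))

      ∣c*∣ : ∀ u → ∣ c* u ∣ ≡ w* u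
      ∣c*∣ u = proj₂ (proj₂ (⊆-ofSize (palette u) (w*≤∣palette∣ u)))

      c*-proper : ∀ u v → InducedAdj G V′ u v → Empty (c* u ∩ c* v)
      c*-proper u v uv (j , j∈) =
        let (j∈u , j∈v)           = x∈p∩q⁻ (c* u) (c* v) j∈
            (z  , z∈u  , j∈cz)  = ∈-⋃-over⁻ c _ (c*⊆palette u j∈u)
            (z′ , z′∈v , j∈cz′) = ∈-⋃-over⁻ c _ (c*⊆palette v j∈v)
        in c-proper z z′ (adj-lift u v uv z∈u z′∈v) (j , x∈p∩q⁺ (j∈cz , j∈cz′))

lemma2 : ∀ {n} (G : Graph n) → 2 ≤ n → Connected G → CoConnected G →
    (V' : Subset n) →
    (∀ (M : Subset n) → IsMaxProperModule G M → ∣ V' ∩ M ∣ ≡ 1) →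
    (w : Fin n → ℕ) →
    (wstar : Vtx V' → ℕ) →
    (∀ (v : Fin n) (p : v ∈ V') (M : Subset n) → IsMaxProperModule G M → v ∈ M →
      IsWChi (InducedAdj G M) (restrict M w) (wstar (v , p))) →
    (k : ℕ) →
    IsWChi (Adj G) w k ⇔ IsWChi (InducedAdj G V') wstar k
lemma2 G 2≤n connected coconnected V′ transversal w w* w*-is-χ =
  IsWChi-⇔ (project w w* block-χ) (refine w w* (proj₁ ∘ block-χ))
  where
  open Quotient G 2≤n connected coconnected V′ transversal

  block-χ : ∀ u → IsWChi (BlockAdj u) (restrict _ w) (w* u)
  block-χ (v , v∈V′) = w*-is-χ v v∈V′ (block v) (block-isMax v) (x∈block v)
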